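{- Let $G$ be a finite double-magical graph. If $\omega(G)=k$, then $\chi(G)\leq\frac{k+1}{2}\binom{k+2}{3}$.
   Context: A double-ordered graph $H_{<,<'}$ (graph with two total orders on its vertex set) is magical if for any three distinct vertices $a< b< c$ with $ab,bc\in E(H)$ and $ac\notin E(H)$ we have $b<' a$ and $b<' c$. A triple-ordered graph $G_{<_1,<_2,<_3}$ (graph with three total orders on its vertex set) is double-magical if there exist graphs $G^1,G^2$ on $V(G)$ such that $G^1_{<_1,<_2}$ and $G^2_{<_1,<_3}$ are magical and $E(G)=E(G^1)\cap E(G^2)$. A graph $G$ is double-magical if there exist total orders $<_1,<_2,<_3$ on $V(G)$ such that $G_{<_1,<_2,<_3}$ is double-magical. $\omega$ and $\chi$ denote clique number and chromatic number. -}

module Defs where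

open import Data.Nat using (ℕ; _*_; _≤_)
open import Data.Nat.Combinatorics using (_C_)
open import Data.Fin using (Fin) renaming (_<_ to _<ᶠ_)
open import Data.Bool using (Bool; true; false)
open import Data.Product using (Σ; _×_; ∃-syntax)
open import Relation.Binary.PropositionalEquality using (_≡_; _≢_)
open import Relation.Nullary using (¬_)
open import Function.Definitions using (Injective)

record Graph (n : ℕ) : Set where
  field
    adj    : Fin n → Fin n → Bool
    sym    : ∀ u v → adj u v ≡ adj v u
    irrefl : ∀ v → adj v v ≡ false
open Graph public

Edge : ∀ {n} → Graph n → Fin n → Fin n → Set
Edge G u v = adj G u v ≡ true

-- A total order on Fin n, encoded by an injective (hence bijective) rank map:
-- a < b  iff  rank a < rank b.
record Order (n : ℕ) : Set where
  field
    rank    : Fin n → Fin n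
    rank-inj : Injective _≡_ _≡_ rank
open Order public

_<[_]_ : ∀ {n} → Fin n → Order n → Fin n → Set
a <[ o ] b = rank o a <ᶠ rank o b

Magical : ∀ {n} → Graph n → Order n → Order n → Set
Magical H o o' = ∀ a b c → a <[ o ] b → b <[ o ] c →
  Edge H a b → Edge H b c → ¬ Edge H a c →
  (b <[ o' ] a) × (b <[ o' ] c)

DoubleMagicalOrd : ∀ {n} → Graph n → Order n → Order n → Order n → Set
DoubleMagicalOrd {n} G o₁ o₂ o₃ = Σ (Graph n) λ G¹ → Σ (Graph n) λ G² →
  Magical G¹ o₁ o₂ × Magical G² o₁ o₃ ×
  (∀ u v → (Edge G u v → Edge G¹ u v × Edge G² u v) ×
           (Edge G¹ u v × Edge G² u v → Edge G u v))

DoubleMagical : ∀ {n} → Graph n → Set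
DoubleMagical {n} G = ∃[ o₁ ] ∃[ o₂ ] ∃[ o₃ ] DoubleMagicalOrd {n} G o₁ o₂ o₃

IsClique : ∀ {n k} → Graph n → (Fin k → Fin n) → Set
IsClique G f = Injective _≡_ _≡_ f × (∀ i j → i ≢ j → Edge G (f i) (f j))

HasClique : ∀ {n} → Graph n → ℕ → Set
HasClique {n} G k = Σ (Fin k → Fin n) (IsClique G)

CliqueNumber : ∀ {n} → Graph n → ℕ → Set
CliqueNumber G k = HasClique G k × (∀ m → HasClique G m → m ≤ k)

ProperColouring : ∀ {n} → Graph n → (m : ℕ) → (Fin n → Fin m) → Set
ProperColouring G m c = ∀ u v → Edge G u v → c u ≢ c v

Colourable : ∀ {n} → Graph n → ℕ → Set
Colourable {n} G m = Σ (Fin n → Fin m) (ProperColouring G m)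

module Submission where

-- A double-magical graph G with clique number k is coloured by a
-- "height profile".  Let <₁,<₂,<₃ be the orders and G = G¹ ∩ G² with G¹
-- magical for (<₁,<₂) and G² magical for (<₁,<₃).  For a vertex v and a
-- pair of flags (p , q), call u a (p , q)-predecessor of v if u <₁ v, uv is an
-- edge, and u <₂ v when p is set, u <₃ v when q is set.  The height h_{p,q}(v)
-- is the length of a longest chain ending in v in which every step from w to u
-- is a predecessor step whose flags record how u compares to the next vertex.
--
-- (1) A generic longest-chain construction on a finite ordered set: heights
--     grow strictly along a step, are monotone in the step relation, and are
--     realised by chains; when steps compose, such chains are pairwise linked.
-- (2) Magicality makes predecessor steps compose, so chains are cliques and
--     every height lies in [1, k].
-- (3) The four heights (h_TT, h_TF, h_FT, h_FF) of a vertex form a quadruple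
--     1 ≤ a ≤ b , c ≤ d ≤ k, adjacent vertices get different quadruples, and
--     there are exactly (k+1)/2 · C(k+2,3) such quadruples.

open import Defs hiding (sym)
open import Data.Nat
  using (ℕ; zero; suc; _+_; _*_; _∸_; _≤_; _<_; _⊔_; z≤n; s≤s)
import Data.Nat.Properties as ℕ
open import Data.Nat.Combinatorics using (_C_; nCk+nC[k+1]≡[n+1]C[k+1]; nC1≡n)
open import Data.Nat.Tactic.RingSolver using (solve)
open import Algebra.Properties.CommutativeSemigroup ℕ.*-commutativeSemigroup
  using (x∙yz≈y∙xz)
open import Data.Fin as Fin using (Fin; toℕ)
import Data.Fin.Properties as Fin
open import Data.Bool as Bool using (Bool; true; false; T)
open import Data.Product using (Σ; _×_; _,_; proj₁; proj₂)
open import Data.Sum using (_⊎_; inj₁; inj₂)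
open import Data.Empty using (⊥-elim)
open import Data.List
  using (List; []; _∷_; [_]; _++_; map; length; lookup; applyUpTo; cartesianProduct)
open import Data.List.Properties using (length-++; length-map; length-applyUpTo)
open import Data.List.Membership.Propositional using (_∈_)
open import Data.List.Membership.Propositional.Properties
  using (∈-++⁺ˡ; ∈-++⁺ʳ; ∈-map⁺; ∈-applyUpTo⁺; ∈-cartesianProduct⁺; ∈-lookup)
import Data.List.Relation.Unary.Any as Any
open import Data.List.Relation.Unary.Any.Properties using (lookup-index)
open import Data.List.Relation.Unary.All as All using (All; []; _∷_)
open import Data.List.Relation.Unary.AllPairs as AllPairs using (AllPairs; []; _∷_)
open import Relation.Binary using (tri<; tri≈; tri>)
open import Relation.Binary.PropositionalEquality
  using (_≡_; _≢_; refl; sym; trans; cong; cong₂; subst; module ≡-Reasoning)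
open import Relation.Nullary using (¬_; Dec; yes; no; ⌊_⌋)
open import Relation.Nullary.Decidable
  using (_×-dec_; _→-dec_; T?; toWitness; fromWitness)

maxFin : ∀ {m} → (Fin m → ℕ) → ℕ
maxFin {zero}  f = 0
maxFin {suc m} f = f Fin.zero ⊔ maxFin (λ i → f (Fin.suc i))

maxFin-upper : ∀ {m} (f : Fin m → ℕ) i → f i ≤ maxFin f
maxFin-upper f Fin.zero    = ℕ.m≤m⊔n _ _
maxFin-upper f (Fin.suc i) =
  ℕ.≤-trans (maxFin-upper (λ j → f (Fin.suc j)) i) (ℕ.m≤n⊔m (f Fin.zero) _)

maxFin-mono : ∀ {m} {f g : Fin m → ℕ} → (∀ i → f i ≤ g i) → maxFin f ≤ maxFin g
maxFin-mono {zero}  f≤g = z≤n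
maxFin-mono {suc m} f≤g =
  ℕ.⊔-mono-≤ (f≤g Fin.zero) (maxFin-mono (λ i → f≤g (Fin.suc i)))

maxFin-cong : ∀ {m} {f g : Fin m → ℕ} → (∀ i → f i ≡ g i) → maxFin f ≡ maxFin g
maxFin-cong f≡g = ℕ.≤-antisym (maxFin-mono (λ i → ℕ.≤-reflexive (f≡g i)))
                              (maxFin-mono (λ i → ℕ.≤-reflexive (sym (f≡g i))))

maxFin-attained : ∀ {m} (f : Fin m → ℕ) →
  maxFin f ≡ 0 ⊎ Σ (Fin m) (λ i → f i ≡ maxFin f)
maxFin-attained {zero}  f = inj₁ refl
maxFin-attained {suc m} f with ℕ.⊔-sel (f Fin.zero) (maxFin (λ i → f (Fin.suc i)))
... | inj₁ left = inj₂ (Fin.zero , sym left)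
... | inj₂ right with maxFin-attained (λ i → f (Fin.suc i))
...   | inj₁ zero≡     = inj₁ (trans right zero≡)
...   | inj₂ (i , fi≡) = inj₂ (Fin.suc i , trans fi≡ (sym right))

-- Longest chains in a finite strictly ordered set.

ifDec : ∀ {P : Set} → Dec P → ℕ → ℕ
ifDec (yes _) x = x
ifDec (no _)  _ = 0

ifDec-mono : ∀ {P Q : Set} (P? : Dec P) (Q? : Dec Q) {x} → (P → Q) →
  ifDec P? x ≤ ifDec Q? x
ifDec-mono (yes p) (yes _) P⇒Q = ℕ.≤-refl
ifDec-mono (yes p) (no ¬q) P⇒Q = ⊥-elim (¬q (P⇒Q p))
ifDec-mono (no _)  Q?      P⇒Q = z≤n

ifDec-yes : ∀ {P : Set} (P? : Dec P) {x} → P → ifDec P? x ≡ x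
ifDec-yes (yes _) p = refl
ifDec-yes (no ¬p) p = ⊥-elim (¬p p)

-- Steps from u to v are labelled by a state s and go downwards in the order o;
-- a chain continues below u in the state next u v.  height s v is the length
-- of a longest chain v > u₁ > u₂ > … starting with an s-step.
module LongestChain {n : ℕ} (o : Order n) {S : Set}
  (Step  : S → Fin n → Fin n → Set)
  (step? : ∀ s u v → Dec (Step s u v))
  (next  : Fin n → Fin n → S)
  (step-down : ∀ {s u v} → Step s u v → u <[ o ] v) where

  heightᵗ : ℕ → S → Fin n → ℕ
  heightᵗ zero    s v = 1
  heightᵗ (suc t) s v = suc (maxFin λ u → ifDec (step? s u v) (heightᵗ t (next u v) u))

  -- A chain below v has at most rank v elements, so once the depth exceeds
  -- rank v the height no longer changes.
  heightᵗ-stable : ∀ t s v → toℕ (rank o v) < t → heightᵗ t s v ≡ heightᵗ (suc t) s v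
  heightᵗ-stable (suc t) s v rank<t = cong suc (maxFin-cong same)
    where
    same : ∀ u → ifDec (step? s u v) (heightᵗ t (next u v) u)
               ≡ ifDec (step? s u v) (heightᵗ (suc t) (next u v) u)
    same u with step? s u v
    ... | yes st = heightᵗ-stable t (next u v) u (ℕ.<-≤-trans (step-down st) (ℕ.≤-pred rank<t))
    ... | no _   = refl

  height : S → Fin n → ℕ
  height = heightᵗ n

  height-positive : ∀ s v → 1 ≤ height s v
  height-positive s v = positive n
    where
    positive : ∀ t → 1 ≤ heightᵗ t s v
    positive zero    = s≤s z≤n
    positive (suc t) = s≤s z≤n

  height-step : ∀ {s u v} → Step s u v → suc (height (next u v) u) ≤ height s v
  height-step {s} {u} {v} st = begin
    suc (heightᵗ n (next u v) u)
      ≡⟨ cong suc (sym (ifDec-yes (step? s u v) st)) ⟩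
    suc (ifDec (step? s u v) (heightᵗ n (next u v) u))
      ≤⟨ s≤s (maxFin-upper (λ w → ifDec (step? s w v) (heightᵗ n (next w v) w)) u) ⟩
    heightᵗ (suc n) s v
      ≡⟨ sym (heightᵗ-stable n s v (Fin.toℕ<n (rank o v))) ⟩
    height s v ∎
    where open ℕ.≤-Reasoning

  height-mono : ∀ {s s' v} → (∀ {u} → Step s' u v → Step s u v) →
    height s' v ≤ height s v
  height-mono {s} {s'} {v} s'⇒s = mono n
    where
    mono : ∀ t → heightᵗ t s' v ≤ heightᵗ t s v
    mono zero    = ℕ.≤-refl
    mono (suc t) = s≤s (maxFin-mono λ u → ifDec-mono (step? s' u v) (step? s u v) s'⇒s)

  module Chains
    (step-compose : ∀ {s u v w} → Step s u v → Step (next u v) w u → Step s w v) where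

    Linked : Fin n → Fin n → Set
    Linked a b = Σ S λ s → Step s b a

    Chain : ℕ → S → Fin n → Set
    Chain h s v = Σ (List (Fin n)) λ K →
      suc (length K) ≡ h × All (λ w → Step s w v) K × AllPairs Linked K

    chainᵗ : ∀ t s v → Chain (heightᵗ t s v) s v
    chainᵗ zero    s v = [] , refl , [] , []
    chainᵗ (suc t) s v with maxFin-attained candidates
      where candidates = λ u → ifDec (step? s u v) (heightᵗ t (next u v) u)
    ... | inj₁ max≡0 = [] , cong suc (sym max≡0) , [] , []
    ... | inj₂ (u , u-max) with step? s u v
    ...   | no _   = [] , cong suc u-max , [] , []
    ...   | yes st with chainᵗ t (next u v) u
    ...     | K , |K| , below-u , linked =
      u ∷ K , cong suc (trans |K| u-max) ,
      st ∷ All.map (step-compose st) below-u ,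
      All.map (next u v ,_) below-u ∷ linked

    longest-chain : ∀ s v → Σ (List (Fin n)) λ K →
      length K ≡ height s v × AllPairs Linked K
    longest-chain s v with chainᵗ n s v
    ... | K , |K| , below-v , linked = v ∷ K , |K| , All.map (s ,_) below-v ∷ linked

<[]-trans : ∀ {n} (o : Order n) {a b c} → a <[ o ] b → b <[ o ] c → a <[ o ] c
<[]-trans o = Fin.<-trans

<[]-asym : ∀ {n} (o : Order n) {a b} → a <[ o ] b → ¬ b <[ o ] a
<[]-asym o = Fin.<-asym

<[]-irrefl : ∀ {n} (o : Order n) {a b} → a <[ o ] b → a ≢ b
<[]-irrefl o a<b refl = Fin.<-irrefl refl a<b

_<?[_]_ : ∀ {n} (a : Fin n) (o : Order n) (b : Fin n) → Dec (a <[ o ] b)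
a <?[ o ] b = rank o a Fin.<? rank o b

edge? : ∀ {n} (G : Graph n) u v → Dec (Edge G u v)
edge? G u v = adj G u v Bool.≟ true

edge-sym : ∀ {n} (G : Graph n) {u v} → Edge G u v → Edge G v u
edge-sym G {u} {v} e = trans (Graph.sym G v u) e

edge-oriented : ∀ {n} (G : Graph n) (o : Order n) {u v} → Edge G u v →
  u <[ o ] v ⊎ v <[ o ] u
edge-oriented G o {u} {v} e with Fin.<-cmp (rank o u) (rank o v)
... | tri< u<v _ _ = inj₁ u<v
... | tri> _ _ v<u = inj₂ v<u
... | tri≈ _ same _ with rank-inj o same
...   | refl with trans (sym e) (irrefl G u)
...     | ()

Adjacent : ∀ {n} → Graph n → Fin n → Fin n → Set
Adjacent G a b = a ≢ b × Edge G a b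

pairwise-clique : ∀ {n} (G : Graph n) (xs : List (Fin n)) →
  AllPairs (Adjacent G) xs → HasClique G (length xs)
pairwise-clique G xs adjacent =
  lookup xs , (λ {i} {j} → injective i j) , (λ i j i≢j → proj₂ (adjacent-at xs adjacent i j i≢j))
  where
  flip-adjacent : ∀ {a b} → Adjacent G a b → Adjacent G b a
  flip-adjacent (a≢b , e) = (λ b≡a → a≢b (sym b≡a)) , edge-sym G e

  adjacent-at : ∀ ys → AllPairs (Adjacent G) ys → ∀ i j → i ≢ j →
    Adjacent G (lookup ys i) (lookup ys j)
  adjacent-at (y ∷ ys) (ry ∷ rys) Fin.zero    Fin.zero    i≢j = ⊥-elim (i≢j refl)
  adjacent-at (y ∷ ys) (ry ∷ rys) Fin.zero    (Fin.suc j) i≢j = All.lookup ry (∈-lookup j)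
  adjacent-at (y ∷ ys) (ry ∷ rys) (Fin.suc i) Fin.zero    i≢j =
    flip-adjacent (All.lookup ry (∈-lookup i))
  adjacent-at (y ∷ ys) (ry ∷ rys) (Fin.suc i) (Fin.suc j) i≢j =
    adjacent-at ys rys i j (λ i≡j → i≢j (cong Fin.suc i≡j))

  injective : ∀ i j → lookup xs i ≡ lookup xs j → i ≡ j
  injective i j same with i Fin.≟ j
  ... | yes i≡j = i≡j
  ... | no i≢j  = ⊥-elim (proj₁ (adjacent-at xs adjacent i j i≢j) same)

list-colouring : ∀ {n} {A : Set} (G : Graph n) (xs : List A) (f : Fin n → A) →
  (∀ v → f v ∈ xs) → (∀ u v → Edge G u v → f u ≢ f v) → Colourable G (length xs)
list-colouring G xs f f∈xs separates =
  (λ v → Any.index (f∈xs v)) ,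
  λ u v e same-index → separates u v e (begin
    f u                             ≡⟨ lookup-index (f∈xs u) ⟩
    lookup xs (Any.index (f∈xs u))  ≡⟨ cong (lookup xs) same-index ⟩
    lookup xs (Any.index (f∈xs v))  ≡⟨ sym (lookup-index (f∈xs v)) ⟩
    f v                             ∎)
  where open ≡-Reasoning

magical-closure : ∀ {n} (H : Graph n) (o o' : Order n) → Magical H o o' →
  ∀ {a b c} → a <[ o ] b → b <[ o ] c → Edge H a b → Edge H b c →
  (b <[ o' ] c → a <[ o' ] b) → Edge H a c
magical-closure H o o' mag {a} {b} {c} a<b b<c eab ebc inherit with edge? H a c
... | yes eac = eac
... | no ¬eac with mag a b c a<b b<c eab ebc ¬eac
...   | b<'a , b<'c = ⊥-elim (<[]-asym o' b<'a (inherit b<'c))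

-- Counting quadruples 1 ≤ a ≤ b , c ≤ d ≤ k.

Quadruple : Set
Quadruple = ℕ × ℕ × ℕ × ℕ

interval : ℕ → ℕ → List ℕ
interval a l = applyUpTo (a +_) l

∈-interval : ∀ {a l x} → a ≤ x → x < a + l → x ∈ interval a l
∈-interval {a} {l} {x} a≤x x<a+l =
  subst (_∈ interval a l) (ℕ.m+[n∸m]≡n a≤x) (∈-applyUpTo⁺ (a +_) x∸a<l)
  where
  x∸a<l : x ∸ a < l
  x∸a<l = subst (x ∸ a <_) (ℕ.m+n∸m≡n a l) (ℕ.∸-monoˡ-< x<a+l a≤x)

length-cartesianProduct : ∀ {A B : Set} (xs : List A) (ys : List B) →
  length (cartesianProduct xs ys) ≡ length xs * length ys
length-cartesianProduct []       ys = refl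
length-cartesianProduct (x ∷ xs) ys = begin
  length (map (x ,_) ys ++ cartesianProduct xs ys)
    ≡⟨ length-++ (map (x ,_) ys) ⟩
  length (map (x ,_) ys) + length (cartesianProduct xs ys)
    ≡⟨ cong₂ _+_ (length-map (x ,_) ys) (length-cartesianProduct xs ys) ⟩
  length ys + length xs * length ys ∎
  where open ≡-Reasoning

square : ℕ → ℕ → List (ℕ × ℕ)
square a l = cartesianProduct (interval a l) (interval a l)

length-square : ∀ a l → length (square a l) ≡ l * l
length-square a l =
  trans (length-cartesianProduct (interval a l) (interval a l))
        (cong₂ _*_ (length-applyUpTo (a +_) l) (length-applyUpTo (a +_) l))

layer : ℕ → ℕ → ℕ → List Quadruple
layer d a zero    = []
layer d a (suc l) = map (λ (b , c) → a , b , c , d) (square a (suc l)) ++ layer d (suc a) l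

∈-layer : ∀ l {d a a' b c} → a ≤ a' → a' ≤ b → a' ≤ c → b < a + l → c < a + l →
  (a' , b , c , d) ∈ layer d a l
∈-layer zero    {a = a} a≤a' a'≤b _ b<a+0 _ =
  ⊥-elim (ℕ.<-irrefl refl (ℕ.<-≤-trans (subst (_ <_) (ℕ.+-identityʳ a) b<a+0)
                                        (ℕ.≤-trans a≤a' a'≤b)))
∈-layer (suc l) {d} {a} {a'} {b} {c} a≤a' a'≤b a'≤c b<a+l c<a+l with a ℕ.≟ a'
... | yes refl =
  ∈-++⁺ˡ (∈-map⁺ (λ (b , c) → a , b , c , d)
    (∈-cartesianProduct⁺ (∈-interval a'≤b b<a+l) (∈-interval a'≤c c<a+l)))
... | no a≢a' =
  ∈-++⁺ʳ _ (∈-layer l (ℕ.≤∧≢⇒< a≤a' a≢a') a'≤b a'≤c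
             (subst (b <_) (ℕ.+-suc a l) b<a+l) (subst (c <_) (ℕ.+-suc a l) c<a+l))

Quadruples : ℕ → List Quadruple
Quadruples zero    = []
Quadruples (suc k) = Quadruples k ++ layer (suc k) 1 (suc k)

∈-Quadruples : ∀ k {a b c d} → 1 ≤ a → a ≤ b → a ≤ c → b ≤ d → c ≤ d → d ≤ k →
  (a , b , c , d) ∈ Quadruples k
∈-Quadruples zero 1≤a a≤b _ b≤d _ d≤0 =
  ⊥-elim (ℕ.<-irrefl refl (ℕ.≤-trans 1≤a (ℕ.≤-trans a≤b (ℕ.≤-trans b≤d d≤0))))
∈-Quadruples (suc k) {d = d} 1≤a a≤b a≤c b≤d c≤d d≤k+1 with d ℕ.≟ suc k
... | yes refl = ∈-++⁺ʳ (Quadruples k) (∈-layer (suc k) 1≤a a≤b a≤c (s≤s b≤d) (s≤s c≤d))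
... | no d≢k+1 =
  ∈-++⁺ˡ (∈-Quadruples k 1≤a a≤b a≤c b≤d c≤d (ℕ.≤-pred (ℕ.≤∧≢⇒< d≤k+1 d≢k+1)))

-- A layer of depth l has 1² + … + l² elements.
six-length-layer : ∀ d a l → 6 * length (layer d a l) ≡ l * suc l * (2 * l + 1)
six-length-layer d a zero    = refl
six-length-layer d a (suc l) = begin
  6 * length (map f (square a (suc l)) ++ layer d (suc a) l)
    ≡⟨ cong (6 *_) (length-++ (map f (square a (suc l)))) ⟩
  6 * (length (map f (square a (suc l))) + length (layer d (suc a) l))
    ≡⟨ ℕ.*-distribˡ-+ 6 (length (map f (square a (suc l)))) (length (layer d (suc a) l)) ⟩
  6 * length (map f (square a (suc l))) + 6 * length (layer d (suc a) l)
    ≡⟨ cong₂ (λ x y → 6 * x + y)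
         (trans (length-map f (square a (suc l))) (length-square a (suc l)))
         (six-length-layer d (suc a) l) ⟩
  6 * (suc l * suc l) + l * suc l * (2 * l + 1)
    ≡⟨ solve [ l ] ⟩
  suc l * suc (suc l) * (2 * suc l + 1) ∎
  where
  open ≡-Reasoning
  f : ℕ × ℕ → Quadruple
  f (b , c) = a , b , c , d

twelve-length-Quadruples : ∀ k → 12 * length (Quadruples k) ≡ k * suc k * suc k * suc (suc k)
twelve-length-Quadruples zero    = refl
twelve-length-Quadruples (suc k) = begin
  12 * length (Quadruples k ++ top)
    ≡⟨ cong (12 *_) (length-++ (Quadruples k)) ⟩
  12 * (length (Quadruples k) + length top)
    ≡⟨ ℕ.*-distribˡ-+ 12 (length (Quadruples k)) (length top) ⟩
  12 * length (Quadruples k) + 12 * length top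
    ≡⟨ cong₂ _+_ (twelve-length-Quadruples k)
         (trans (ℕ.*-assoc 2 6 (length top)) (cong (2 *_) (six-length-layer (suc k) 1 (suc k)))) ⟩
  k * suc k * suc k * suc (suc k) + 2 * (suc k * suc (suc k) * (2 * suc k + 1))
    ≡⟨ solve [ k ] ⟩
  suc k * suc (suc k) * suc (suc k) * suc (suc (suc k)) ∎
  where
  open ≡-Reasoning
  top : List Quadruple
  top = layer (suc k) 1 (suc k)

two-choose-2 : ∀ n → 2 * (suc n C 2) ≡ suc n * n
two-choose-2 zero    = refl
two-choose-2 (suc n) = begin
  2 * (suc (suc n) C 2)            ≡⟨ cong (2 *_) (sym (nCk+nC[k+1]≡[n+1]C[k+1] (suc n) 1)) ⟩
  2 * (suc n C 1 + suc n C 2)      ≡⟨ ℕ.*-distribˡ-+ 2 (suc n C 1) (suc n C 2) ⟩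
  2 * (suc n C 1) + 2 * (suc n C 2) ≡⟨ cong₂ (λ x y → 2 * x + y) (nC1≡n (suc n)) (two-choose-2 n) ⟩
  2 * suc n + suc n * n            ≡⟨ solve [ n ] ⟩
  suc (suc n) * suc n              ∎
  where open ≡-Reasoning

six-choose-3 : ∀ n → 6 * (suc (suc n) C 3) ≡ suc (suc n) * suc n * n
six-choose-3 zero    = refl
six-choose-3 (suc n) = begin
  6 * (suc (suc (suc n)) C 3)
    ≡⟨ cong (6 *_) (sym (nCk+nC[k+1]≡[n+1]C[k+1] (suc (suc n)) 2)) ⟩
  6 * (suc (suc n) C 2 + suc (suc n) C 3)
    ≡⟨ ℕ.*-distribˡ-+ 6 (suc (suc n) C 2) (suc (suc n) C 3) ⟩
  6 * (suc (suc n) C 2) + 6 * (suc (suc n) C 3)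
    ≡⟨ cong₂ _+_ (trans (ℕ.*-assoc 3 2 (suc (suc n) C 2)) (cong (3 *_) (two-choose-2 (suc n))))
                 (six-choose-3 n) ⟩
  3 * (suc (suc n) * suc n) + suc (suc n) * suc n * n
    ≡⟨ solve [ n ] ⟩
  suc (suc (suc n)) * suc (suc n) * suc n ∎
  where open ≡-Reasoning

count-Quadruples : ∀ k → 2 * length (Quadruples k) ≡ (k + 1) * ((k + 2) C 3)
count-Quadruples k = ℕ.*-cancelˡ-≡ (2 * length (Quadruples k)) ((k + 1) * ((k + 2) C 3)) 6 (begin
  6 * (2 * length (Quadruples k))
    ≡⟨ ℕ.*-assoc 6 2 (length (Quadruples k)) ⟨
  12 * length (Quadruples k)
    ≡⟨ twelve-length-Quadruples k ⟩
  k * suc k * suc k * suc (suc k)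
    ≡⟨ solve [ k ] ⟩
  (k + 1) * (suc (suc k) * suc k * k)
    ≡⟨ cong ((k + 1) *_) (six-choose-3 k) ⟨
  (k + 1) * (6 * (suc (suc k) C 3))
    ≡⟨ x∙yz≈y∙xz (k + 1) 6 (suc (suc k) C 3) ⟩
  6 * ((k + 1) * (suc (suc k) C 3))
    ≡⟨ cong (λ m → 6 * ((k + 1) * (m C 3))) (ℕ.+-comm 2 k) ⟩
  6 * ((k + 1) * ((k + 2) C 3)) ∎)
  where open ≡-Reasoning

-- Heights in a double-magical graph.

module DoubleMagicalHeights {n : ℕ} (G : Graph n) (o₁ o₂ o₃ : Order n)
  (G¹ G² : Graph n) (mag₁ : Magical G¹ o₁ o₂) (mag₂ : Magical G² o₁ o₃)
  (split : ∀ u v → (Edge G u v → Edge G¹ u v × Edge G² u v) ×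
                   (Edge G¹ u v × Edge G² u v → Edge G u v)) where

  edge-closure : ∀ {w u v} → w <[ o₁ ] u → u <[ o₁ ] v → Edge G w u → Edge G u v →
    (u <[ o₂ ] v → w <[ o₂ ] u) → (u <[ o₃ ] v → w <[ o₃ ] u) → Edge G w v
  edge-closure {w} {u} {v} w<u u<v ewu euv inherit₂ inherit₃ =
    proj₂ (split w v)
      ( magical-closure G¹ o₁ o₂ mag₁ w<u u<v (proj₁ ewu¹²) (proj₁ euv¹²) inherit₂
      , magical-closure G² o₁ o₃ mag₂ w<u u<v (proj₂ ewu¹²) (proj₂ euv¹²) inherit₃ )
    where
    ewu¹² = proj₁ (split w u) ewu
    euv¹² = proj₁ (split u v) euv

  Flags : Set
  Flags = Bool × Bool

  Step : Flags → Fin n → Fin n → Set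
  Step (p , q) u v =
    u <[ o₁ ] v × Edge G u v × (T p → u <[ o₂ ] v) × (T q → u <[ o₃ ] v)

  step? : ∀ s u v → Dec (Step s u v)
  step? (p , q) u v =
    (u <?[ o₁ ] v) ×-dec edge? G u v ×-dec
    (T? p →-dec (u <?[ o₂ ] v)) ×-dec (T? q →-dec (u <?[ o₃ ] v))

  next : Fin n → Fin n → Flags
  next u v = ⌊ u <?[ o₂ ] v ⌋ , ⌊ u <?[ o₃ ] v ⌋

  edge-step : ∀ {u v} → u <[ o₁ ] v → Edge G u v → Step (next u v) u v
  edge-step u<v e = u<v , e , toWitness , toWitness

  -- A step below a step is a step: this is where both magical graphs are used.
  step-compose : ∀ {s u v w} → Step s u v → Step (next u v) w u → Step s w v
  step-compose (u<₁v , euv , p⇒u<₂v , q⇒u<₃v) (w<₁u , ewu , w<₂u , w<₃u) =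
    <[]-trans o₁ w<₁u u<₁v ,
    edge-closure w<₁u u<₁v ewu euv (λ u<₂v → w<₂u (fromWitness u<₂v))
                                   (λ u<₃v → w<₃u (fromWitness u<₃v)) ,
    (λ p → <[]-trans o₂ (w<₂u (fromWitness (p⇒u<₂v p))) (p⇒u<₂v p)) ,
    (λ q → <[]-trans o₃ (w<₃u (fromWitness (q⇒u<₃v q))) (q⇒u<₃v q))

  open LongestChain o₁ Step step? next proj₁ public
  open Chains step-compose

  -- Heights are bounded by the clique number: a longest chain is a clique.
  height-≤-ω : ∀ {k} → CliqueNumber G k → ∀ s v → height s v ≤ k
  height-≤-ω (_ , maximal) s v with longest-chain s v
  ... | K , |K| , linked =
    subst (_≤ _) |K| (maximal (length K) (pairwise-clique G K (AllPairs.map adjacent linked)))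
    where
    adjacent : ∀ {a b} → Linked a b → Adjacent G a b
    adjacent (_ , b<a , eba , _) = (λ a≡b → <[]-irrefl o₁ b<a (sym a≡b)) , edge-sym G eba

  step-weaken : ∀ {p q p' q' u v} → (T p' → T p) → (T q' → T q) →
    Step (p , q) u v → Step (p' , q') u v
  step-weaken p'⇒p q'⇒q (u<v , e , p⇒ , q⇒) =
    u<v , e , (λ p' → p⇒ (p'⇒p p')) , (λ q' → q⇒ (q'⇒q q'))

  profile : Fin n → Quadruple
  profile v = height (true , true) v , height (true , false) v ,
              height (false , true) v , height (false , false) v

  entry : Flags → Quadruple → ℕ
  entry (true  , true)  (a , b , c , d) = a
  entry (true  , false) (a , b , c , d) = b
  entry (false , true)  (a , b , c , d) = c
  entry (false , false) (a , b , c , d) = d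

  entry-profile : ∀ s v → entry s (profile v) ≡ height s v
  entry-profile (true  , true)  v = refl
  entry-profile (true  , false) v = refl
  entry-profile (false , true)  v = refl
  entry-profile (false , false) v = refl

  -- The profile is a quadruple 1 ≤ a ≤ b , c ≤ d ≤ k: the TT steps are the
  -- most restrictive, the FF steps the least, and all heights are at most ω.
  profile∈Quadruples : ∀ {k} → CliqueNumber G k → ∀ v → profile v ∈ Quadruples k
  profile∈Quadruples {k} ω=k v =
    ∈-Quadruples k (height-positive _ v)
      (height-mono (step-weaken (λ p → p) (λ ())))
      (height-mono (step-weaken (λ ()) (λ q → q)))
      (height-mono (step-weaken (λ ()) (λ ())))
      (height-mono (step-weaken (λ ()) (λ ())))
      (height-≤-ω ω=k (false , false) v)

  -- Along an edge u <₁ v the height in the flags next u v strictly increases,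
  -- so the profiles of u and v differ.
  profile-increases : ∀ {u v} → u <[ o₁ ] v → Edge G u v → profile u ≢ profile v
  profile-increases {u} {v} u<v e same =
    ℕ.<-irrefl equal-heights (height-step (edge-step u<v e))
    where
    equal-heights : height (next u v) u ≡ height (next u v) v
    equal-heights = trans (sym (entry-profile (next u v) u))
                   (trans (cong (entry (next u v)) same) (entry-profile (next u v) v))

  profile-separates : ∀ u v → Edge G u v → profile u ≢ profile v
  profile-separates u v e with edge-oriented G o₁ e
  ... | inj₁ u<v = profile-increases u<v e
  ... | inj₂ v<u = λ same → profile-increases v<u (edge-sym G e) (sym same)

theorem8 : (n : ℕ) (G : Graph n) (k : ℕ) → DoubleMagical G → CliqueNumber G k →
    Σ ℕ λ m → Colourable G m × (2 * m ≤ (k + 1) * ((k + 2) C 3))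
theorem8 n G k (o₁ , o₂ , o₃ , G¹ , G² , mag₁ , mag₂ , split) ω=k =
  length (Quadruples k) ,
  list-colouring G (Quadruples k) profile (profile∈Quadruples ω=k) profile-separates ,
  ℕ.≤-reflexive (count-Quadruples k)
  where open DoubleMagicalHeights G o₁ o₂ o₃ G¹ G² mag₁ mag₂ split
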